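{- Let $(C_i)_{i\ge1}$ be an enumeration of the tuatara machines, and define the Turing machine $W$ by $W(0^i1x)=C_i(x)$ for all $i\ge1$ and $x\in\Sigma^*$ (with $W$ undefined on all other inputs). Then $W$ is a universal tuatara machine.
   Context: Turing machines map binary strings to binary strings (partial functions on $\Sigma^*$, $\Sigma=\{0,1\}$); $\mathrm{dom}(M)$ is the set of inputs on which $M$ halts. $\mathrm{bin}:\mathbf{N}=\{1,2,\dots\}\to\Sigma^*$ is the bijection sending $n$ to its binary expansion with the leading 1 removed. $\zeta_M=\sum_{n\ge1,\ \mathrm{bin}(n)\in\mathrm{dom}(M)}\frac1n$; $M$ is a tuatara machine if $\zeta_M\le1$. A Turing machine $W$ is universal for a class $\Re$ of Turing machines if for every $C\in\Re$ there is a constant $c\ge0$ such that for every $x\in\mathrm{dom}(C)$ there is $p_x\in\mathrm{dom}(W)$ with $|p_x|\le|x|+c$ and $W(p_x)=C(x)$. A universal tuatara machine is a tuatara machine universal for the class of tuatara machines. -}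

module Defs where

open import Level using (Level; suc; _⊔_)
open import Data.Bool using (Bool; true; false)
open import Data.Nat as ℕ using (ℕ; _∸_)
open import Data.Integer using (+_)
open import Data.List using (List; []; _∷_; foldl; foldr; map; length; replicate; _++_)
open import Data.List.Relation.Unary.All using (All)
open import Data.List.Relation.Unary.Unique.Propositional using (Unique)
open import Data.Rational.Unnormalised using (ℚᵘ; mkℚᵘ; 0ℚᵘ; 1ℚᵘ) renaming (_+_ to _+q_; _≤_ to _≤q_)
open import Data.Product using (Σ; ∃; _×_)
open import Relation.Binary.PropositionalEquality using (_≡_)

-- Binary strings over Σ = {0,1}; 0 is false, 1 is true.
Str : Set
Str = List Bool

bit : Bool → ℕ
bit false = 0
bit true  = 1

-- num s = the natural number whose binary expansion is "1s".
-- This is the inverse of the paper's bijection bin : {1,2,...} → Σ*,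
-- i.e. bin n ≡ s  iff  num s ≡ n.
num : Str → ℕ
num = foldl (λ acc b → 2 ℕ.* acc ℕ.+ bit b) 1

-- An abstract model of computation: machines denoting partial functions
-- Σ* ⇀ Σ* through a (deterministic) halting-with-output relation.
record Model (a b : Level) : Set (suc (a ⊔ b)) where
  field
    Machine : Set a
    _⟦_⟧⇓_  : Machine → Str → Str → Set b
    deterministic : ∀ {M x y z} → M ⟦ x ⟧⇓ y → M ⟦ x ⟧⇓ z → y ≡ z

module _ {a b} (𝕄 : Model a b) where
  open Model 𝕄

  InDom : Machine → Str → Set b
  InDom M x = ∃ λ y → M ⟦ x ⟧⇓ y

  BinInDom : Machine → ℕ → Set b
  BinInDom M n = Σ Str λ s → num s ≡ n × InDom M s

  -- 1/n for n ≥ 1 (as an unnormalised rational; denominator n)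
  inv : ℕ → ℚᵘ
  inv n = mkℚᵘ (+ 1) (n ∸ 1)

  sumℚ : List ℚᵘ → ℚᵘ
  sumℚ = foldr _+q_ 0ℚᵘ

  -- ζ_M ≤ 1 : every finite partial sum of the nonnegative series
  -- Σ_{n ≥ 1, bin(n) ∈ dom M} 1/n is at most 1.
  Tuatara : Machine → Set b
  Tuatara M = (ns : List ℕ) → Unique ns → All (BinInDom M) ns →
              sumℚ (map inv ns) ≤q 1ℚᵘ

  UniversalFor : (Machine → Set b) → Machine → Set (a ⊔ b)
  UniversalFor P W =
    (C : Machine) → P C → Σ ℕ λ c → (x : Str) → InDom C x →
      Σ Str λ p → length p ℕ.≤ length x ℕ.+ c ×
        ∃ λ y → W ⟦ p ⟧⇓ y × C ⟦ x ⟧⇓ y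

  UniversalTuatara : Machine → Set (a ⊔ b)
  UniversalTuatara W = Tuatara W × UniversalFor Tuatara W

{-# OPTIONS --safe #-}
-- A program 0ⁱ1x of W has binary value num (0ⁱ1x) ≥ 2ⁱ · num x: the prefix 0ⁱ
-- multiplies by 2ⁱ and the inserted 1 outweighs the whole of x. Hence the programs
-- of W that run C_i contribute at most 2⁻ⁱ ζ(C_i) ≤ 2⁻ⁱ to ζ(W), and summing over
-- i ≥ 1 gives ζ(W) ≤ 1. Universality is immediate: x becomes 0ⁱ1x, i + 1 bits longer.
module Submission where

open import Defs

module BinaryNumeral where
  open import Data.Bool using (Bool; true; false)
  open import Data.Nat using (ℕ; _+_; _*_; _^_; _≤_; _<_; s≤s; z≤n)
  open import Data.Nat.Properties
  open import Data.Nat.Tactic.RingSolver using (solve-∀)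
  open import Data.List using (List; []; _∷_; foldl; length; replicate; reverse; _++_)
  open import Data.List.Properties
    using ( foldl-++; foldl-∷ʳ; unfold-reverse; reverse-involutive; reverse-injective
          ; length-++; length-replicate )
  open import Data.Product using (_×_; _,_; proj₁)
  open import Relation.Binary.PropositionalEquality
  open import Relation.Nullary using (contradiction)

  appendBit : ℕ → Bool → ℕ
  appendBit n b = 2 * n + bit b

  bit≤1 : ∀ b → bit b ≤ 1
  bit≤1 false = z≤n
  bit≤1 true  = s≤s z≤n

  appendBit-injective : ∀ m n b c → appendBit m b ≡ appendBit n c → m ≡ n × b ≡ c
  appendBit-injective m n false false eq = *-cancelˡ-≡ m n 2 (+-cancelʳ-≡ 0 _ _ eq) , refl
  appendBit-injective m n true  true  eq = *-cancelˡ-≡ m n 2 (+-cancelʳ-≡ 1 _ _ eq) , refl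
  appendBit-injective m n false true  eq =
    contradiction (trans (sym (+-identityʳ _)) (trans eq (+-comm _ 1))) (even≢odd m n)
  appendBit-injective m n true  false eq =
    contradiction (trans (sym (+-identityʳ _)) (trans (sym eq) (+-comm _ 1))) (even≢odd n m)

  *2^length≤foldl-appendBit : ∀ n bs → n * 2 ^ length bs ≤ foldl appendBit n bs
  *2^length≤foldl-appendBit n []       = ≤-reflexive (*-identityʳ n)
  *2^length≤foldl-appendBit n (b ∷ bs) = begin
    n * (2 * 2 ^ length bs)            ≡⟨ *-assoc n 2 _ ⟨
    n * 2 * 2 ^ length bs              ≤⟨ *-monoˡ-≤ _ (≤-trans (≤-reflexive (*-comm n 2)) (m≤m+n _ (bit b))) ⟩
    appendBit n b * 2 ^ length bs      ≤⟨ *2^length≤foldl-appendBit (appendBit n b) bs ⟩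
    foldl appendBit (appendBit n b) bs ∎
    where open ≤-Reasoning

  foldl-appendBit<suc*2^length : ∀ n bs → foldl appendBit n bs < (1 + n) * 2 ^ length bs
  foldl-appendBit<suc*2^length n []       = ≤-reflexive (sym (*-identityʳ (1 + n)))
  foldl-appendBit<suc*2^length n (b ∷ bs) = begin-strict
    foldl appendBit (appendBit n b) bs    <⟨ foldl-appendBit<suc*2^length (appendBit n b) bs ⟩
    (1 + appendBit n b) * 2 ^ length bs   ≤⟨ *-monoˡ-≤ _ (+-monoʳ-≤ 1 (+-monoʳ-≤ (2 * n) (bit≤1 b))) ⟩
    (1 + (2 * n + 1)) * 2 ^ length bs     ≡⟨ double-suc n (2 ^ length bs) ⟩
    (1 + n) * (2 * 2 ^ length bs)         ∎
    where
    open ≤-Reasoning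
    double-suc : ∀ n m → (1 + (2 * n + 1)) * m ≡ (1 + n) * (2 * m)
    double-suc = solve-∀

  2^length≤num : ∀ bs → 2 ^ length bs ≤ num bs
  2^length≤num bs = ≤-trans (≤-reflexive (sym (*-identityˡ _))) (*2^length≤foldl-appendBit 1 bs)

  num-positive : ∀ bs → 1 ≤ num bs
  num-positive bs = ≤-trans (m^n>0 2 (length bs)) (2^length≤num bs)

  num*num≤num-++-true : ∀ bs cs → num bs * num cs ≤ num (bs ++ true ∷ cs)
  num*num≤num-++-true bs cs = begin
    num bs * num cs                      ≤⟨ *-monoʳ-≤ (num bs) (<⇒≤ (foldl-appendBit<suc*2^length 1 cs)) ⟩
    num bs * (2 * 2 ^ length cs)         ≡⟨ rearrange (num bs) (2 ^ length cs) ⟩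
    2 * num bs * 2 ^ length cs           ≤⟨ *-monoˡ-≤ (2 ^ length cs) (m≤m+n (2 * num bs) 1) ⟩
    (2 * num bs + 1) * 2 ^ length cs     ≤⟨ *2^length≤foldl-appendBit (appendBit (num bs) true) cs ⟩
    foldl appendBit (num bs) (true ∷ cs) ≡⟨ foldl-++ appendBit 1 bs (true ∷ cs) ⟨
    num (bs ++ true ∷ cs)                ∎
    where
    open ≤-Reasoning
    rearrange : ∀ n m → n * (2 * m) ≡ 2 * n * m
    rearrange = solve-∀

  num-reverse-∷ : ∀ b bs → num (reverse (b ∷ bs)) ≡ appendBit (num (reverse bs)) b
  num-reverse-∷ b bs = trans (cong num (unfold-reverse b bs)) (foldl-∷ʳ appendBit 1 b (reverse bs))

  -- In the mixed cases num [] = 1 = appendBit 0 true would force a numeral to be 0.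
  num-reverse-injective : ∀ bs cs → num (reverse bs) ≡ num (reverse cs) → bs ≡ cs
  num-reverse-injective [] [] _ = refl
  num-reverse-injective [] (c ∷ cs) eq =
    contradiction (proj₁ (appendBit-injective 0 _ true c (trans eq (num-reverse-∷ c cs))))
                  (<⇒≢ (num-positive (reverse cs)))
  num-reverse-injective (b ∷ bs) [] eq =
    contradiction (proj₁ (appendBit-injective 0 _ true b (trans (sym eq) (num-reverse-∷ b bs))))
                  (<⇒≢ (num-positive (reverse bs)))
  num-reverse-injective (b ∷ bs) (c ∷ cs) eq
    with eq′ , refl ← appendBit-injective _ _ b c
                        (trans (sym (num-reverse-∷ b bs)) (trans eq (num-reverse-∷ c cs)))
    = cong (b ∷_) (num-reverse-injective bs cs eq′)

  num-injective : ∀ {bs cs} → num bs ≡ num cs → bs ≡ cs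
  num-injective {bs} {cs} eq = reverse-injective (num-reverse-injective (reverse bs) (reverse cs)
    (trans (cong num (reverse-involutive bs)) (trans eq (cong num (sym (reverse-involutive cs))))))

  program : ℕ → Str → Str
  program i x = replicate i false ++ true ∷ x

  length-program : ∀ i x → length (program i x) ≡ length x + (1 + i)
  length-program i x = begin
    length (replicate i false ++ true ∷ x) ≡⟨ length-++ (replicate i false) ⟩
    length (replicate i false) + (1 + length x) ≡⟨ cong (_+ (1 + length x)) (length-replicate i) ⟩
    i + (1 + length x)                          ≡⟨ +-comm i (1 + length x) ⟩
    1 + (length x + i)                          ≡⟨ +-suc (length x) i ⟨
    length x + (1 + i)                          ∎
    where open ≡-Reasoning

  2^*num≤num-program : ∀ i x → 2 ^ i * num x ≤ num (program i x)
  2^*num≤num-program i x = begin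
    2 ^ i * num x                          ≡⟨ cong (λ k → 2 ^ k * num x) (length-replicate i) ⟨
    2 ^ length (replicate i false) * num x ≤⟨ *-monoˡ-≤ (num x) (2^length≤num (replicate i false)) ⟩
    num (replicate i false) * num x        ≤⟨ num*num≤num-++-true (replicate i false) x ⟩
    num (program i x)                      ∎
    where open ≤-Reasoning

module UnitFractionSum where
  open import Level using (Level)
  open import Data.Nat as ℕ using (ℕ; zero; suc; _∸_; _^_; _<_; s≤s; z≤n)
  import Data.Nat.Properties as ℕ
  open import Data.Integer using (+_; +≤+)
  open import Data.Rational.Unnormalised
    using (ℚᵘ; mkℚᵘ; 0ℚᵘ; 1ℚᵘ; ½; _+_; _*_; _≤_; _≃_; *≡*; *≤*)
  open import Data.Rational.Unnormalised.Properties
  open import Data.List using (List; []; _∷_; map; foldr)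
  open import Data.List.Properties using (map-∘)
  open import Data.List.Relation.Unary.All as All using (All; []; _∷_)
  import Data.List.Relation.Unary.All.Properties as All
  open import Data.List.Relation.Unary.AllPairs using ([]; _∷_)
  open import Data.List.Relation.Unary.Unique.Propositional using (Unique)
  import Data.List.Relation.Unary.Unique.Propositional.Properties as Unique
  open import Data.List.Relation.Binary.Sublist.Propositional as Sublist using ([]; _∷_; _∷ʳ_)
  open import Data.List.Relation.Binary.Sublist.Propositional.Properties using (All-resp-⊆)
  open import Data.List.Extrema.Nat using (max; xs≤max)
  open import Data.Product as Product using (Σ; _×_; _,_; proj₁; proj₂; uncurry)
  open import Function using (_∘_)
  open import Relation.Binary.PropositionalEquality using (_≡_; refl; cong; sym; subst)
  open import Relation.Unary using (Pred; _⊆_)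
  open import Algebra.Bundles using (CommutativeMonoid)
  import Algebra.Properties.CommutativeSemigroup as CommutativeSemigroupProperties
  open BinaryNumeral using (num-positive; program; 2^*num≤num-program)

  private variable
    a ℓ : Level
    A B : Set a

  infix  8 1/_
  infixl 7 _/2^_

  -- Defs' inv and sumℚ without their unused model argument. Note 1/ 0 = 1.
  1/_ : ℕ → ℚᵘ
  1/ n = mkℚᵘ (+ 1) (n ∸ 1)

  sum : List ℚᵘ → ℚᵘ
  sum = foldr _+_ 0ℚᵘ

  _/2^_ : ℚᵘ → ℕ → ℚᵘ
  q /2^ zero  = q
  q /2^ suc i = ½ * (q /2^ i)

  1/-antitone : ∀ {m n} → m ℕ.≤ n → 1/ n ≤ 1/ m
  1/-antitone m≤n = *≤* (+≤+ (ℕ.+-monoˡ-≤ 0 (s≤s (ℕ.∸-monoˡ-≤ 1 m≤n))))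

  1/-double : ∀ {n} → 1 ℕ.≤ n → 1/ (2 ℕ.* n) ≃ ½ * 1/ n
  1/-double {suc n} _ = *≡* refl

  1/-2^* : ∀ i {n} → 1 ℕ.≤ n → 1/ (2 ^ i ℕ.* n) ≃ 1/ n /2^ i
  1/-2^* zero    {n} _   = ≃-reflexive (cong 1/_ (ℕ.*-identityˡ n))
  1/-2^* (suc i) {n} 1≤n = begin
    1/ (2 ℕ.* 2 ^ i ℕ.* n)   ≡⟨ cong 1/_ (ℕ.*-assoc 2 (2 ^ i) n) ⟩
    1/ (2 ℕ.* (2 ^ i ℕ.* n)) ≈⟨ 1/-double (ℕ.*-mono-≤ (ℕ.m^n>0 2 i) 1≤n) ⟩
    ½ * 1/ (2 ^ i ℕ.* n)     ≈⟨ *-congˡ (1/-2^* i 1≤n) ⟩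
    ½ * (1/ n /2^ i)         ∎
    where open ≃-Reasoning

  1/num-program≤ : ∀ i x → 1/ num (program i x) ≤ 1/ num x /2^ i
  1/num-program≤ i x = begin
    1/ num (program i x) ≤⟨ 1/-antitone (2^*num≤num-program i x) ⟩
    1/ (2 ^ i ℕ.* num x) ≃⟨ 1/-2^* i (num-positive x) ⟩
    1/ num x /2^ i       ∎
    where open ≤-Reasoning

  sum-map-mono : {f g : A → ℚᵘ} → (∀ x → f x ≤ g x) → ∀ xs → sum (map f xs) ≤ sum (map g xs)
  sum-map-mono f≤g []       = ≤-refl
  sum-map-mono f≤g (x ∷ xs) = +-mono-≤ (f≤g x) (sum-map-mono f≤g xs)

  sum-map-*ˡ : ∀ q (f : A → ℚᵘ) xs → sum (map (λ x → q * f x) xs) ≃ q * sum (map f xs)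
  sum-map-*ˡ q f []       = ≃-sym (*-zeroʳ q)
  sum-map-*ˡ q f (x ∷ xs) = ≃-trans (+-congʳ (q * f x) (sum-map-*ˡ q f xs))
                                    (≃-sym (*-distribˡ-+ q (f x) (sum (map f xs))))

  -- Tuatara 𝕄 M unfolds to SumBounded 1/_ (Image num (InDom 𝕄 M)).
  SumBounded : (A → ℚᵘ) → Pred A ℓ → Set _
  SumBounded {A = A} f P = (xs : List A) → Unique xs → All P xs → sum (map f xs) ≤ 1ℚᵘ

  Image : (A → B) → Pred A ℓ → Pred B _
  Image {A = A} g P y = Σ A λ x → g x ≡ y × P x

  preimages : {g : A → B} {P : Pred A ℓ} {ys : List B} → All (Image g P) ys →
              Σ (List A) λ xs → map g xs ≡ ys × All P xs
  preimages [] = [] , refl , []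
  preimages ((x , refl , px) ∷ images) with xs , refl , pxs ← preimages images =
    x ∷ xs , refl , px ∷ pxs

  SumBounded-∘ : {f : B → ℚᵘ} {g : A → B} {P : Pred A ℓ} → (∀ {x y} → g x ≡ g y → x ≡ y) →
                 SumBounded f (Image g P) → SumBounded (f ∘ g) P
  SumBounded-∘ {g = g} g-injective bounded xs distinct pxs =
    subst (λ ys → sum ys ≤ 1ℚᵘ) (sym (map-∘ xs))
      (bounded (map g xs) (Unique.map⁺ g-injective distinct)
                          (All.map⁺ (All.map (λ px → _ , refl , px) pxs)))

  SumBounded-image : {f : B → ℚᵘ} {g : A → B} {h : A → ℚᵘ} {P : Pred A ℓ} {Q : Pred B ℓ} →
                     Q ⊆ Image g P → (∀ x → f (g x) ≤ h x) → SumBounded h P → SumBounded f Q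
  SumBounded-image {f = f} {g} {h} Q⊆image f∘g≤h bounded ys distinct qys
    with xs , refl , pxs ← preimages (All.map Q⊆image qys) = begin
    sum (map f (map g xs)) ≡⟨ cong sum (map-∘ xs) ⟨
    sum (map (f ∘ g) xs)   ≤⟨ sum-map-mono f∘g≤h xs ⟩
    sum (map h xs)         ≤⟨ bounded xs (Unique.map⁻ distinct) pxs ⟩
    1ℚᵘ                    ∎
    where open ≤-Reasoning

  levelWeight : (A → ℚᵘ) → ℕ × A → ℚᵘ
  levelWeight f (j , x) = f x /2^ suc j

  Unique-resp-⊆ : {xs ys : List A} → xs Sublist.⊆ ys → Unique ys → Unique xs
  Unique-resp-⊆ []             []                = []
  Unique-resp-⊆ (_ ∷ʳ xs⊆ys)   (_ ∷ distinct)    = Unique-resp-⊆ xs⊆ys distinct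
  Unique-resp-⊆ (refl ∷ xs⊆ys) (y∉ys ∷ distinct) =
    All-resp-⊆ xs⊆ys y∉ys ∷ Unique-resp-⊆ xs⊆ys distinct

  splitLevel₀ : List (ℕ × A) → List A × List (ℕ × A)
  splitLevel₀ []                 = [] , []
  splitLevel₀ ((zero  , x) ∷ es) = Product.map₁ (x ∷_) (splitLevel₀ es)
  splitLevel₀ ((suc j , x) ∷ es) = Product.map₂ ((j , x) ∷_) (splitLevel₀ es)

  splitLevel₀-⊆₁ : (es : List (ℕ × A)) → map (0 ,_) (proj₁ (splitLevel₀ es)) Sublist.⊆ es
  splitLevel₀-⊆₁ []                 = []
  splitLevel₀-⊆₁ ((zero  , x) ∷ es) = refl ∷ splitLevel₀-⊆₁ es
  splitLevel₀-⊆₁ ((suc j , x) ∷ es) = _ ∷ʳ splitLevel₀-⊆₁ es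

  splitLevel₀-⊆₂ : (es : List (ℕ × A)) →
                   map (Product.map₁ suc) (proj₂ (splitLevel₀ es)) Sublist.⊆ es
  splitLevel₀-⊆₂ []                 = []
  splitLevel₀-⊆₂ ((zero  , x) ∷ es) = _ ∷ʳ splitLevel₀-⊆₂ es
  splitLevel₀-⊆₂ ((suc j , x) ∷ es) = refl ∷ splitLevel₀-⊆₂ es

  sum-splitLevel₀ : (w : ℕ × A → ℚᵘ) (es : List (ℕ × A)) →
    sum (map w es) ≃ sum (map (w ∘ (0 ,_)) (proj₁ (splitLevel₀ es)))
                   + sum (map (w ∘ Product.map₁ suc) (proj₂ (splitLevel₀ es)))
  sum-splitLevel₀ w []                 = *≡* refl
  sum-splitLevel₀ w ((zero  , x) ∷ es) =
    ≃-trans (+-congʳ (w (0 , x)) (sum-splitLevel₀ w es)) (≃-sym (+-assoc (w (0 , x)) _ _))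
  sum-splitLevel₀ w ((suc j , x) ∷ es) =
    ≃-trans (+-congʳ (w (suc j , x)) (sum-splitLevel₀ w es))
            (x∙yz≈y∙xz (w (suc j , x)) (sum (map (w ∘ (0 ,_)) (proj₁ (splitLevel₀ es)))) _)
    where open CommutativeSemigroupProperties (CommutativeMonoid.commutativeSemigroup +-0-commutativeMonoid)

  -- The level-0 terms add up to ½ · (at most 1), and the others to ½ times the same kind
  -- of sum with every level lowered by one. That does not shorten the list, so the
  -- induction is on a strict bound N for the levels.
  SumBounded-levels< : ∀ N {D : ℕ → Pred A ℓ} {f : A → ℚᵘ} → (∀ j → SumBounded f (D j)) →
    ∀ es → All ((_< N) ∘ proj₁) es → Unique es → All (uncurry D) es →
    sum (map (levelWeight f) es) ≤ 1ℚᵘ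
  SumBounded-levels< zero    hyp []      _        _ _ = *≤* (+≤+ z≤n)
  SumBounded-levels< zero    hyp (_ ∷ _) (() ∷ _) _ _
  SumBounded-levels< (suc N) {D} {f} hyp es below distinct des = begin
    sum (map (levelWeight f) es)
      ≃⟨ sum-splitLevel₀ (levelWeight f) es ⟩
    sum (map (λ x → ½ * f x) level₀) + sum (map (λ e → ½ * levelWeight f e) higher)
      ≃⟨ +-cong (sum-map-*ˡ ½ f level₀) (sum-map-*ˡ ½ (levelWeight f) higher) ⟩
    ½ * sum (map f level₀) + ½ * sum (map (levelWeight f) higher)
      ≤⟨ +-mono-≤ (*-monoʳ-≤-nonNeg ½ level₀-bound) (*-monoʳ-≤-nonNeg ½ higher-bound) ⟩
    ½ * 1ℚᵘ + ½ * 1ℚᵘ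
      ≃⟨ *≡* refl ⟩
    1ℚᵘ ∎
    where
    open ≤-Reasoning
    level₀ = proj₁ (splitLevel₀ es)
    higher = proj₂ (splitLevel₀ es)
    ⊆₁ = splitLevel₀-⊆₁ es
    ⊆₂ = splitLevel₀-⊆₂ es
    level₀-bound : sum (map f level₀) ≤ 1ℚᵘ
    level₀-bound = hyp 0 level₀
      (Unique.map⁻ (Unique-resp-⊆ ⊆₁ distinct))
      (All.map⁻ (All-resp-⊆ ⊆₁ des))
    higher-bound : sum (map (levelWeight f) higher) ≤ 1ℚᵘ
    higher-bound = SumBounded-levels< N (hyp ∘ suc) higher
      (All.map ℕ.≤-pred (All.map⁻ (All-resp-⊆ ⊆₂ below)))
      (Unique.map⁻ (Unique-resp-⊆ ⊆₂ distinct))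
      (All.map⁻ (All-resp-⊆ ⊆₂ des))

  SumBounded-levels : {D : ℕ → Pred A ℓ} {f : A → ℚᵘ} → (∀ j → SumBounded f (D j)) →
                      SumBounded (levelWeight f) (uncurry D)
  SumBounded-levels hyp es = SumBounded-levels< (suc (max 0 (map proj₁ es))) hyp es
    (All.map⁻ (All.map s≤s (xs≤max 0 (map proj₁ es))))

open BinaryNumeral using (num-injective; program; length-program)
open UnitFractionSum using (SumBounded-∘; SumBounded-image; SumBounded-levels; 1/num-program≤)
open import Data.Bool using (true; false)
open import Data.Nat using (ℕ; suc; _≤_; s≤s; z≤n)
open import Data.Nat.Properties using (≤-reflexive)
open import Data.List using (_∷_; _++_; replicate)
open import Data.Product using (Σ; _×_; _,_; uncurry)
open import Function using (_∘_)
open import Relation.Binary.PropositionalEquality using (_≡_; refl)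

module _ {a b} (𝕄 : Model a b) where
  open Model 𝕄

  decodes⇒Tuatara : (C : ℕ → Machine) → ((i : ℕ) → 1 ≤ i → Tuatara 𝕄 (C i)) →
    (W : Machine) →
    ((s y : Str) → W ⟦ s ⟧⇓ y →
       Σ ℕ λ i → Σ Str λ x → 1 ≤ i × s ≡ program i x × C i ⟦ x ⟧⇓ y) →
    Tuatara 𝕄 W
  decodes⇒Tuatara C C-tuatara W decodes =
    SumBounded-image {g = num ∘ uncurry (program ∘ suc)} {P = uncurry (InDom 𝕄 ∘ C ∘ suc)}
      decoded (λ (j , x) → 1/num-program≤ (suc j) x)
      (SumBounded-levels (λ j → SumBounded-∘ num-injective (C-tuatara (suc j) (s≤s z≤n))))
    where
    decoded : ∀ {n} → BinInDom 𝕄 W n →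
              Σ (ℕ × Str) λ (j , x) → num (program (suc j) x) ≡ n × InDom 𝕄 (C (suc j)) x
    decoded (s , refl , y , W⇓y) with decodes s y W⇓y
    ... | suc j , x , _ , refl , C⇓y = (j , x) , refl , y , C⇓y

  simulates⇒UniversalFor : {P : Machine → Set b} (C : ℕ → Machine) →
    ((M : Machine) → P M → Σ ℕ λ i → 1 ≤ i × C i ≡ M) → (W : Machine) →
    ((i : ℕ) → 1 ≤ i → (x y : Str) → C i ⟦ x ⟧⇓ y → W ⟦ program i x ⟧⇓ y) →
    UniversalFor 𝕄 P W
  simulates⇒UniversalFor C enumerates W simulates M PM with i , 1≤i , refl ← enumerates M PM =
    suc i , λ x (y , C⇓y) →
      program i x , ≤-reflexive (length-program i x) , y , simulates i 1≤i x y C⇓y , C⇓y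

theorem25 : ∀ {a b} (𝕄 : Model a b) → let open Model 𝕄 in
    (C : ℕ → Machine) →
    ((i : ℕ) → 1 ≤ i → Tuatara 𝕄 (C i)) →
    ((M : Machine) → Tuatara 𝕄 M → Σ ℕ λ i → 1 ≤ i × C i ≡ M) →
    (W : Machine) →
    ((s y : Str) → W ⟦ s ⟧⇓ y →
       Σ ℕ λ i → Σ Str λ x → 1 ≤ i × s ≡ replicate i false ++ true ∷ x × C i ⟦ x ⟧⇓ y) →
    ((i : ℕ) → 1 ≤ i → (x y : Str) → C i ⟦ x ⟧⇓ y → W ⟦ replicate i false ++ true ∷ x ⟧⇓ y) →
    UniversalTuatara 𝕄 W
theorem25 𝕄 C C-tuatara enumerates W decodes simulates =
  decodes⇒Tuatara 𝕄 C C-tuatara W decodes , simulates⇒UniversalFor 𝕄 C enumerates W simulates
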